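{- A reflexive tournament is endo-trivial if and only if it is retract-trivial.
   Context: A reflexive tournament is a digraph with more than one vertex, a loop at every vertex, and for every two distinct vertices $u,v$ exactly one of $(u,v),(v,u)$ as an edge. An endomorphism is a homomorphism from a digraph to itself (a vertex map sending edges to edges); an automorphism is a bijective endomorphism whose inverse is a homomorphism. A digraph is endo-trivial if all its endomorphisms are automorphisms or constant maps. A retraction of a digraph $\mathrm{G}$ is an endomorphism $r$ of $\mathrm{G}$ that is the identity on its image $r(V(\mathrm{G}))$. A digraph is retract-trivial if all its retractions are the identity or constant maps. -}

module Defs where

open import Data.Nat using (ℕ; _≥_)
open import Data.Fin using (Fin)
open import Data.Bool using (Bool; true)
open import Data.Product using (Σ; ∃; _×_)
open import Data.Sum using (_⊎_)
open import Relation.Nullary using (¬_)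
open import Relation.Binary.PropositionalEquality using (_≡_; _≢_)

record Digraph (n : ℕ) : Set where
  field
    adj : Fin n → Fin n → Bool

open Digraph public

Edge : ∀ {n} → Digraph n → Fin n → Fin n → Set
Edge G u v = adj G u v ≡ true

IsReflexiveTournament : ∀ {n} → Digraph n → Set
IsReflexiveTournament {n} G =
  (n ≥ 2) ×
  ((u : Fin n) → Edge G u u) ×
  ((u v : Fin n) → u ≢ v →
     (Edge G u v ⊎ Edge G v u) × ¬ (Edge G u v × Edge G v u))

IsEndomorphism : ∀ {n} → Digraph n → (Fin n → Fin n) → Set
IsEndomorphism {n} G f = (u v : Fin n) → Edge G u v → Edge G (f u) (f v)

IsAutomorphism : ∀ {n} → Digraph n → (Fin n → Fin n) → Set
IsAutomorphism {n} G f =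
  IsEndomorphism G f ×
  Σ (Fin n → Fin n) (λ g →
     ((x : Fin n) → g (f x) ≡ x) ×
     ((x : Fin n) → f (g x) ≡ x) ×
     IsEndomorphism G g)

IsConstant : ∀ {n} → (Fin n → Fin n) → Set
IsConstant {n} f = Σ (Fin n) (λ c → (x : Fin n) → f x ≡ c)

IsIdentity : ∀ {n} → (Fin n → Fin n) → Set
IsIdentity {n} f = (x : Fin n) → f x ≡ x

IsRetraction : ∀ {n} → Digraph n → (Fin n → Fin n) → Set
IsRetraction {n} G r =
  IsEndomorphism G r × ((y : Fin n) → Σ (Fin n) (λ x → r x ≡ y) → r y ≡ y)

EndoTrivial : ∀ {n} → Digraph n → Set
EndoTrivial {n} G =
  (f : Fin n → Fin n) → IsEndomorphism G f → IsAutomorphism G f ⊎ IsConstant f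

RetractTrivial : ∀ {n} → Digraph n → Set
RetractTrivial {n} G =
  (r : Fin n → Fin n) → IsRetraction G r → IsIdentity r ⊎ IsConstant r

-- Every endomorphism f of a reflexive tournament gives a retraction: collapse a fibre
-- f⁻¹(f c) onto c and fix everything else.  Because f maps the tournament into itself
-- and edges are antisymmetric, every edge between the fibre and its complement is
-- oriented the same way as the corresponding edge at c, so the collapse is a
-- homomorphism.  If all retractions are trivial, each fibre is either a singleton or
-- everything, so f is injective (hence, being a map of a finite set, a bijection whose
-- inverse is again a homomorphism by antisymmetry) or constant.  Conversely a retraction
-- that is an automorphism fixes its image, which is everything.
module Submission where

open import Defs
open import Data.Nat using (ℕ; suc; _≥_; s≤s)
open import Data.Nat.Properties using (1+n≰n)
open import Data.Fin using (Fin; zero; punchOut)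
open import Data.Fin.Properties using (_≟_; any?; all?; punchOut-injective; injective⇒≤)
open import Data.Product using (_×_; _,_; proj₁; proj₂; ∃)
open import Data.Sum using (_⊎_; inj₁; inj₂)
open import Data.Empty using (⊥-elim)
open import Function using (_∘_)
open import Function.Definitions using (Injective)
open import Relation.Nullary using (yes; no; contradiction)
open import Relation.Binary.PropositionalEquality

injective⇒surjective : ∀ {n} {f : Fin n → Fin n} → Injective _≡_ _≡_ f →
  (y : Fin n) → ∃ λ x → f x ≡ y
injective⇒surjective {suc m} {f} f-inj y with any? (λ x → f x ≟ y)
... | yes hit = hit
... | no miss = contradiction (injective⇒≤ {f = squeeze} squeeze-inj) 1+n≰n
  where
  y≢f : (x : Fin (suc m)) → y ≢ f x
  y≢f x y≡fx = miss (x , sym y≡fx)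

  squeeze : Fin (suc m) → Fin m
  squeeze x = punchOut (y≢f x)

  squeeze-inj : Injective _≡_ _≡_ squeeze
  squeeze-inj {x} {z} eq = f-inj (punchOut-injective (y≢f x) (y≢f z) eq)

retraction-with-rightInverse⇒identity : ∀ {n} (G : Digraph n) {r g : Fin n → Fin n} →
  IsRetraction G r → (∀ y → r (g y) ≡ y) → IsIdentity r
retraction-with-rightInverse⇒identity G (_ , fixes-image) r∘g≗id y =
  fixes-image y (_ , r∘g≗id y)

endoTrivial⇒retractTrivial : ∀ {n} (G : Digraph n) → EndoTrivial G → RetractTrivial G
endoTrivial⇒retractTrivial G endo-trivial r r-retraction
  with endo-trivial r (proj₁ r-retraction)
... | inj₁ (_ , g , _ , r∘g≗id , _) =
  inj₁ (retraction-with-rightInverse⇒identity G r-retraction r∘g≗id)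
... | inj₂ r-constant = inj₂ r-constant

module ReflexiveTournamentProperties {n} (T : Digraph n) (RT : IsReflexiveTournament T) where

  edge-refl : (u : Fin n) → Edge T u u
  edge-refl = proj₁ (proj₂ RT)

  edge-total : (u v : Fin n) → Edge T u v ⊎ Edge T v u
  edge-total u v with u ≟ v
  ... | yes refl = inj₁ (edge-refl u)
  ... | no u≢v = proj₁ (proj₂ (proj₂ RT) u v u≢v)

  edge-antisym : ∀ {u v} → Edge T u v → Edge T v u → u ≡ v
  edge-antisym {u} {v} uv vu with u ≟ v
  ... | yes u≡v = u≡v
  ... | no u≢v = ⊥-elim (proj₂ (proj₂ (proj₂ RT) u v u≢v) (uv , vu))

  rightInverse-isEndomorphism : ∀ {f g} → IsEndomorphism T f → (∀ x → f (g x) ≡ x) →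
    IsEndomorphism T g
  rightInverse-isEndomorphism {f} {g} f-endo f∘g≗id u v uv with edge-total (g u) (g v)
  ... | inj₁ guv = guv
  ... | inj₂ gvu = subst (Edge T (g u) ∘ g) u≡v (edge-refl (g u))
    where
    u≡v : u ≡ v
    u≡v = edge-antisym uv (subst₂ (Edge T) (f∘g≗id v) (f∘g≗id u) (f-endo _ _ gvu))

  injective-endomorphism⇒automorphism : ∀ {f} → IsEndomorphism T f →
    Injective _≡_ _≡_ f → IsAutomorphism T f
  injective-endomorphism⇒automorphism {f} f-endo f-inj =
    f-endo , g , (λ x → f-inj (f∘g≗id (f x))) , f∘g≗id ,
    rightInverse-isEndomorphism f-endo f∘g≗id
    where
    g : Fin n → Fin n
    g = proj₁ ∘ injective⇒surjective f-inj

    f∘g≗id : ∀ x → f (g x) ≡ x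
    f∘g≗id = proj₂ ∘ injective⇒surjective f-inj

  module FibreCollapse {f : Fin n → Fin n} (f-endo : IsEndomorphism T f) where

    collapse : Fin n → Fin n → Fin n
    collapse c v with f v ≟ f c
    ... | yes _ = c
    ... | no _ = v

    edge-leaving-fibre : ∀ c {u v} → f u ≡ f c → f v ≢ f c → Edge T u v → Edge T c v
    edge-leaving-fibre c {u} {v} fu≡fc fv≢fc uv with edge-total c v
    ... | inj₁ cv = cv
    ... | inj₂ vc = contradiction
      (edge-antisym (f-endo v c vc) (subst (λ w → Edge T w (f v)) fu≡fc (f-endo u v uv)))
      fv≢fc

    edge-entering-fibre : ∀ c {u v} → f u ≢ f c → f v ≡ f c → Edge T u v → Edge T u c
    edge-entering-fibre c {u} {v} fu≢fc fv≡fc uv with edge-total u c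
    ... | inj₁ uc = uc
    ... | inj₂ cu = contradiction
      (edge-antisym (subst (Edge T (f u)) fv≡fc (f-endo u v uv)) (f-endo c u cu))
      fu≢fc

    collapse-isEndomorphism : ∀ c → IsEndomorphism T (collapse c)
    collapse-isEndomorphism c u v uv with f u ≟ f c | f v ≟ f c
    ... | yes _ | yes _ = edge-refl c
    ... | yes fu≡fc | no fv≢fc = edge-leaving-fibre c fu≡fc fv≢fc uv
    ... | no fu≢fc | yes fv≡fc = edge-entering-fibre c fu≢fc fv≡fc uv
    ... | no _ | no _ = uv

    collapse-fixesImage : ∀ c y → ∃ (λ x → collapse c x ≡ y) → collapse c y ≡ y
    collapse-fixesImage c y (x , cx≡y) with f y ≟ f c
    ... | no _ = refl
    ... | yes fy≡fc with f x ≟ f c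
    ...   | yes _ = cx≡y
    ...   | no fx≢fc = contradiction (subst (λ w → f w ≡ f c) (sym cx≡y) fy≡fc) fx≢fc

    collapse-isRetraction : ∀ c → IsRetraction T (collapse c)
    collapse-isRetraction c = collapse-isEndomorphism c , collapse-fixesImage c

    collapse-self : ∀ c → collapse c c ≡ c
    collapse-self c with f c ≟ f c
    ... | yes _ = refl
    ... | no fc≢fc = contradiction refl fc≢fc

    collapse-constant⇒fibre-full : ∀ c → IsConstant (collapse c) → ∀ v → f v ≡ f c
    collapse-constant⇒fibre-full c (d , ≡d) v with f v ≟ f c | ≡d v
    ... | yes fv≡fc | _ = fv≡fc
    ... | no _ | v≡d = cong f (trans v≡d (trans (sym (≡d c)) (collapse-self c)))

    collapse-identity⇒fibre-singleton : ∀ c → IsIdentity (collapse c) →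
      ∀ v → f v ≡ f c → v ≡ c
    collapse-identity⇒fibre-singleton c collapse≗id v fv≡fc with f v ≟ f c | collapse≗id v
    ... | yes _ | c≡v = sym c≡v
    ... | no fv≢fc | _ = contradiction fv≡fc fv≢fc

  retractTrivial⇒endoTrivial : Fin n → RetractTrivial T → EndoTrivial T
  retractTrivial⇒endoTrivial c retract-trivial f f-endo with all? (λ v → f v ≟ f c)
  ... | yes constant = inj₂ (f c , constant)
  ... | no nonconstant = inj₁ (injective-endomorphism⇒automorphism f-endo f-inj)
    where
    open FibreCollapse f-endo

    f-inj : Injective _≡_ _≡_ f
    f-inj {u} {v} fu≡fv with retract-trivial (collapse u) (collapse-isRetraction u)
    ... | inj₁ collapse≗id = sym (collapse-identity⇒fibre-singleton u collapse≗id v (sym fu≡fv))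
    ... | inj₂ collapse-constant = contradiction
      (λ w → trans (full w) (sym (full c))) nonconstant
      where
      full : ∀ w → f w ≡ f u
      full = collapse-constant⇒fibre-full u collapse-constant

some-vertex : ∀ {n} → n ≥ 2 → Fin n
some-vertex (s≤s _) = zero

lemma5 : {n : ℕ} (T : Digraph n) → IsReflexiveTournament T →
    (EndoTrivial T → RetractTrivial T) × (RetractTrivial T → EndoTrivial T)
lemma5 T RT@(n≥2 , _) =
  endoTrivial⇒retractTrivial T ,
  ReflexiveTournamentProperties.retractTrivial⇒endoTrivial T RT (some-vertex n≥2)
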